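{- Let $T$ be a theory in the language of category theory plus constants which is term-complete. Then $T$ has the existence property if and only if, whenever $T\vdash\exists\Delta\,P(\Delta)$ for a context $\Delta$ and formula $P(\Delta)$, there is a variable assignment $c:\Delta\to\mathcal C(T)$ such that $T\vdash P(c)$.
   Context: The language of category theory is a dependently sorted first-order language (intuitionistic) with object sort, arrow sorts $X\to Y$, identities, composition, and equality only between arrows of the same sort; theories may have object and arrow constants and contain the category and equality axioms. A context is a list of distinct typed variables, each arrow variable's source and target being constants or earlier variables; $\exists\Delta$ is iterated existential quantification over the variables of $\Delta$. $\mathcal C(T)_\Delta$ is the collection of terms in context $\Delta$; $\mathcal C(T)$ denotes closed terms. A variable assignment $c:\Theta\to\mathcal C(T)_\Delta$ sends object variables of $\Theta$ to object-terms in context $\Delta$ and each arrow variable $v:A\to B$ to an arrow-term $c_A\to c_B$; $P(c)$ is substitution. Context isomorphism $\Delta_1\cong\Delta_2$ between renamed copies: isomorphisms $f_V:V_1\to V_2$ for object variables $V$ (identities on terms not from $\Delta$), commuting with each arrow variable $g:A\to B$ ($g_2\circ f_A=f_B\circ g_1$). $\exists!\Delta\,P(\Delta)$ means $\exists\Delta\,P(\Delta)$ and any two $\Delta_1,\Delta_2$ satisfying $P$ have a unique context isomorphism between them. $T$ is term-complete if whenever $T\vdash\exists!\Delta\,P(\Delta)$ there is a variable assignment $c:\Delta\to\mathcal C(T)$ with $T\vdash P(c)$. $T$ has the existence property if for every context $\Theta$ and formula $P(\Theta)$ with $T\vdash\exists\Theta\,P(\Theta)$ there exist a context $\Delta$,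 a variable assignment $c:\Theta\to\mathcal C(T)_\Delta$ and a formula $Q(\Delta)$ with $T\vdash\exists!\Delta\,Q(\Delta)$ and $T\vdash\exists\Delta\,(Q(\Delta)\wedge P(c))$. -}

module Defs where

open import Data.List using (List; []; _∷_; _++_; map)
open import Data.List.Membership.Propositional using (_∈_)
open import Data.Product using (Σ; _×_; _,_; proj₁; proj₂)
open import Function using (_∘_; id)
open import Function.Bundles using (_⇔_)

record Signature : Set₁ where
  field
    OC  : Set
    AC  : Set
    src : AC → OC
    tgt : AC → OC

data Kind : Set where
  obj arr : Kind

-- A scope lists the kinds of the variables in scope, most recent first.
Scope : Set
Scope = List Kind

data Var : Scope → Kind → Set where
  vz : ∀ {s k} → Var (k ∷ s) k
  vs : ∀ {s k k'} → Var s k → Var (k' ∷ s) k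

Ren : Scope → Scope → Set
Ren s t = ∀ {k} → Var s k → Var t k

injV : ∀ {s b} → Ren s (s ++ b)
injV vz     = vz
injV (vs v) = vs (injV v)

raiseV : ∀ (b : Scope) {s} → Ren s (b ++ s)
raiseV []      v = v
raiseV (_ ∷ b) v = vs (raiseV b v)

from[] : ∀ {t} → Ren [] t
from[] ()

module Lang (Sg : Signature) where
  open Signature Sg

  data OTm (s : Scope) : Set where
    ovar : Var s obj → OTm s
    ocon : OC → OTm s

  data ATm (s : Scope) : Set where
    avar : Var s arr → ATm s
    acon : AC → ATm s
    idt  : OTm s → ATm s
    comp : ATm s → ATm s → ATm s     -- comp g f  is  g ∘ f

  KTm : Kind → Scope → Set
  KTm obj = OTm
  KTm arr = ATm

  renO : ∀ {s t} → Ren s t → OTm s → OTm t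
  renO ρ (ovar v) = ovar (ρ v)
  renO ρ (ocon c) = ocon c

  renA : ∀ {s t} → Ren s t → ATm s → ATm t
  renA ρ (avar v)   = avar (ρ v)
  renA ρ (acon a)   = acon a
  renA ρ (idt X)    = idt (renO ρ X)
  renA ρ (comp g f) = comp (renA ρ g) (renA ρ f)

  renK : ∀ {k s t} → Ren s t → KTm k s → KTm k t
  renK {obj} = renO
  renK {arr} = renA

  Sub : Scope → Scope → Set
  Sub s t = ∀ {k} → Var s k → KTm k t

  idS : ∀ {s} → Sub s s
  idS {k = obj} v = ovar v
  idS {k = arr} v = avar v

  liftS : ∀ {s t k'} → Sub s t → Sub (k' ∷ s) (k' ∷ t)
  liftS {k' = obj} σ vz = ovar vz
  liftS {k' = arr} σ vz = avar vz
  liftS σ (vs v) = renK vs (σ v)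

  subO : ∀ {s t} → Sub s t → OTm s → OTm t
  subO σ (ovar v) = σ v
  subO σ (ocon c) = ocon c

  subA : ∀ {s t} → Sub s t → ATm s → ATm t
  subA σ (avar v)   = σ v
  subA σ (acon a)   = acon a
  subA σ (idt X)    = idt (subO σ X)
  subA σ (comp g f) = comp (subA σ g) (subA σ f)

  infixr 6 _∧ᶠ_
  infixr 5 _∨ᶠ_
  infixr 4 _⇒ᶠ_
  infix  7 _≐_

  data Fm (s : Scope) : Set where
    ⊤ᶠ ⊥ᶠ      : Fm s
    _∧ᶠ_ _∨ᶠ_ _⇒ᶠ_ : Fm s → Fm s → Fm s
    _≐_         : ATm s → ATm s → Fm s
    ∀o ∃o       : Fm (obj ∷ s) → Fm s
    ∀a ∃a       : OTm s → OTm s → Fm (arr ∷ s) → Fm s   -- ∀ (v : X → Y) φ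

  subF : ∀ {s t} → Sub s t → Fm s → Fm t
  subF σ ⊤ᶠ         = ⊤ᶠ
  subF σ ⊥ᶠ         = ⊥ᶠ
  subF σ (φ ∧ᶠ ψ)   = subF σ φ ∧ᶠ subF σ ψ
  subF σ (φ ∨ᶠ ψ)   = subF σ φ ∨ᶠ subF σ ψ
  subF σ (φ ⇒ᶠ ψ)   = subF σ φ ⇒ᶠ subF σ ψ
  subF σ (f ≐ g)    = subA σ f ≐ subA σ g
  subF σ (∀o φ)     = ∀o (subF (liftS σ) φ)
  subF σ (∃o φ)     = ∃o (subF (liftS σ) φ)
  subF σ (∀a X Y φ) = ∀a (subO σ X) (subO σ Y) (subF (liftS σ) φ)
  subF σ (∃a X Y φ) = ∃a (subO σ X) (subO σ Y) (subF (liftS σ) φ)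

  renF : ∀ {s t} → Ren s t → Fm s → Fm t
  renF ρ = subF (idS ∘ ρ)

  wkF : ∀ {s k} → Fm s → Fm (k ∷ s)
  wkF = renF vs

  extS : ∀ {s k} → KTm k s → Sub (k ∷ s) s
  extS t vz     = t
  extS t (vs v) = idS v

  _[_]o : ∀ {s} → Fm (obj ∷ s) → OTm s → Fm s
  φ [ X ]o = subF (extS X) φ

  _[_]a : ∀ {s} → Fm (arr ∷ s) → ATm s → Fm s
  φ [ f ]a = subF (extS f) φ

  -- Contexts / telescopes.  Tel b s extends scope b to scope s; an arrow
  -- variable's source and target are object terms (constants or earlier
  -- object variables) of the preceding scope.

  infixl 5 _▷o _▷[_⇒_]

  data Tel (b : Scope) : Scope → Set where
    ε       : Tel b b
    _▷o     : ∀ {s} → Tel b s → Tel b (obj ∷ s)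
    _▷[_⇒_] : ∀ {s} → Tel b s → OTm s → OTm s → Tel b (arr ∷ s)

  Ctx : Scope → Set
  Ctx = Tel []

  _++T_ : ∀ {a b c} → Tel a b → Tel b c → Tel a c
  Γ ++T ε               = Γ
  Γ ++T (Δ ▷o)          = (Γ ++T Δ) ▷o
  Γ ++T (Δ ▷[ X ⇒ Y ])  = (Γ ++T Δ) ▷[ X ⇒ Y ]

  copy : ∀ {s} → Ctx s → (b : Scope) → Tel b (s ++ b)
  copy ε               b = ε
  copy (Δ ▷o)          b = copy Δ b ▷o
  copy (Δ ▷[ X ⇒ Y ])  b = copy Δ b ▷[ renO injV X ⇒ renO injV Y ]

  exs : ∀ {b s} → Tel b s → Fm s → Fm b
  exs ε              φ = φ
  exs (Δ ▷o)         φ = exs Δ (∃o φ)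
  exs (Δ ▷[ X ⇒ Y ]) φ = exs Δ (∃a X Y φ)

  alls : ∀ {b s} → Tel b s → Fm s → Fm b
  alls ε              φ = φ
  alls (Δ ▷o)         φ = alls Δ (∀o φ)
  alls (Δ ▷[ X ⇒ Y ]) φ = alls Δ (∀a X Y φ)

  arrTy : ∀ {s} → Ctx s → Var s arr → OTm s × OTm s
  arrTy (Δ ▷o)         (vs v) = renO vs (proj₁ (arrTy Δ v)) , renO vs (proj₂ (arrTy Δ v))
  arrTy (Δ ▷[ X ⇒ Y ]) vz     = renO vs X , renO vs Y
  arrTy (Δ ▷[ X ⇒ Y ]) (vs v) = renO vs (proj₁ (arrTy Δ v)) , renO vs (proj₂ (arrTy Δ v))

  data _⊢_∶_⟶_ {s} (Γ : Ctx s) : ATm s → OTm s → OTm s → Set where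
    tvar  : (g : Var s arr) → Γ ⊢ avar g ∶ proj₁ (arrTy Γ g) ⟶ proj₂ (arrTy Γ g)
    tcon  : (a : AC) → Γ ⊢ acon a ∶ ocon (src a) ⟶ ocon (tgt a)
    tid   : (X : OTm s) → Γ ⊢ idt X ∶ X ⟶ X
    tcomp : ∀ {f g X Y Z} → Γ ⊢ f ∶ X ⟶ Y → Γ ⊢ g ∶ Y ⟶ Z → Γ ⊢ comp g f ∶ X ⟶ Z

  data _⊢wf_ {s} (Γ : Ctx s) : Fm s → Set where
    w⊤ : Γ ⊢wf ⊤ᶠ
    w⊥ : Γ ⊢wf ⊥ᶠ
    w∧ : ∀ {φ ψ} → Γ ⊢wf φ → Γ ⊢wf ψ → Γ ⊢wf (φ ∧ᶠ ψ)
    w∨ : ∀ {φ ψ} → Γ ⊢wf φ → Γ ⊢wf ψ → Γ ⊢wf (φ ∨ᶠ ψ)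
    w⇒ : ∀ {φ ψ} → Γ ⊢wf φ → Γ ⊢wf ψ → Γ ⊢wf (φ ⇒ᶠ ψ)
    w≐ : ∀ {f g X Y} → Γ ⊢ f ∶ X ⟶ Y → Γ ⊢ g ∶ X ⟶ Y → Γ ⊢wf (f ≐ g)
    w∀o : ∀ {φ} → (Γ ▷o) ⊢wf φ → Γ ⊢wf ∀o φ
    w∃o : ∀ {φ} → (Γ ▷o) ⊢wf φ → Γ ⊢wf ∃o φ
    w∀a : ∀ {X Y φ} → (Γ ▷[ X ⇒ Y ]) ⊢wf φ → Γ ⊢wf ∀a X Y φ
    w∃a : ∀ {X Y φ} → (Γ ▷[ X ⇒ Y ]) ⊢wf φ → Γ ⊢wf ∃a X Y φ

  -- variable assignment c : Θ → 𝒞(T)_Δ  (well-typed substitution)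
  WfSub : ∀ {s t} → Ctx s → Ctx t → Sub s t → Set
  WfSub Θ Δ c = (g : Var _ arr) →
    Δ ⊢ c g ∶ subO c (proj₁ (arrTy Θ g)) ⟶ subO c (proj₂ (arrTy Θ g))

  ⋀ : ∀ {t} (s : Scope) → (∀ {k} → Var s k → Fm t) → Fm t
  ⋀ []      φ = ⊤ᶠ
  ⋀ (k ∷ s) φ = φ vz ∧ᶠ ⋀ s (φ ∘ vs)

  -- Telescope of candidate components f_V : V₁ → V₂, one for each object
  -- variable V of Δ, where ρ₁, ρ₂ locate the two copies of Δ in scope b.
  record IsoTel (b s : Scope) : Set where
    constructor isoTel
    field
      scope : Scope
      tel   : Tel b scope
      fam   : Var s obj → ATm scope
      wk    : Ren b scope

  buildIso : ∀ {s b} → Ctx s → Ren s b → Ren s b → IsoTel b s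
  buildIso ε ρ₁ ρ₂ = isoTel _ ε (λ ()) id
  buildIso (Δ ▷o) ρ₁ ρ₂ with buildIso Δ (ρ₁ ∘ vs) (ρ₂ ∘ vs)
  ... | isoTel t F fm w =
    isoTel (arr ∷ t) (F ▷[ ovar (w (ρ₁ vz)) ⇒ ovar (w (ρ₂ vz)) ])
           (λ { vz → avar vz ; (vs v) → renA vs (fm v) }) (vs ∘ w)
  buildIso (Δ ▷[ X ⇒ Y ]) ρ₁ ρ₂ with buildIso Δ (ρ₁ ∘ vs) (ρ₂ ∘ vs)
  ... | isoTel t F fm w = isoTel t F (λ { (vs v) → fm v }) w

  fOf : ∀ {s t} → (Var s obj → ATm t) → OTm s → ATm t
  fOf fm (ovar v) = fm v
  fOf fm (ocon c) = idt (ocon c)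

  IsIso : ∀ {s t} → Ctx s → Ren s t → Ren s t → (Var s obj → ATm t) → Fm t
  IsIso {s} Δ ρ₁ ρ₂ fm = ⋀ s cond
    where
    cond : ∀ {k} → Var s k → Fm _
    cond {obj} v =
      ∃a (ovar (ρ₂ v)) (ovar (ρ₁ v))
         ((comp (avar vz) (renA vs (fm v)) ≐ idt (ovar (vs (ρ₁ v))))
          ∧ᶠ (comp (renA vs (fm v)) (avar vz) ≐ idt (ovar (vs (ρ₂ v)))))
    cond {arr} g =
      comp (avar (ρ₂ g)) (fOf fm (proj₁ (arrTy Δ g)))
        ≐ comp (fOf fm (proj₂ (arrTy Δ g))) (avar (ρ₁ g))

  SameIso : ∀ {s t} → (Var s obj → ATm t) → (Var s obj → ATm t) → Fm t
  SameIso {s} fm fm' = ⋀ s cond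
    where
    cond : ∀ {k} → Var s k → Fm _
    cond {obj} v = fm v ≐ fm' v
    cond {arr} g = ⊤ᶠ

  ExU : ∀ {s} → Ctx s → Fm s → Fm []
  ExU {s} Δ P =
    exs Δ P ∧ᶠ
    alls ΔΔ ((renF ρ₁ P ∧ᶠ renF ρ₂ P) ⇒ᶠ (exs F (IsIso Δ (w ∘ ρ₁) (w ∘ ρ₂) fm) ∧ᶠ uniq))
    where
    ΔΔ : Ctx (s ++ s)
    ΔΔ = Δ ++T copy Δ s
    ρ₁ : Ren s (s ++ s)
    ρ₁ = raiseV s
    ρ₂ : Ren s (s ++ s)
    ρ₂ = injV
    I₁ = buildIso Δ ρ₁ ρ₂
    open IsoTel I₁ renaming (scope to t; tel to F; fam to fm; wk to w)
    I₂ = buildIso Δ (w ∘ ρ₁) (w ∘ ρ₂)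
    open IsoTel I₂ renaming (scope to t'; tel to F'; fam to fm'; wk to w')
    σ₁ : Ren s t'
    σ₁ = w' ∘ w ∘ ρ₁
    σ₂ : Ren s t'
    σ₂ = w' ∘ w ∘ ρ₂
    uniq : Fm (s ++ s)
    uniq = alls F (alls F'
             ((IsIso Δ σ₁ σ₂ (renA w' ∘ fm) ∧ᶠ IsIso Δ σ₁ σ₂ fm')
               ⇒ᶠ SameIso (renA w' ∘ fm) fm'))

  module Deriv (Ax : Fm [] → Set) where

    infix 2 _∣_⊢_

    data _∣_⊢_ {s} (Γ : Ctx s) (Φ : List (Fm s)) : Fm s → Set where
      ax   : ∀ {ψ} → Ax ψ → Γ ∣ Φ ⊢ renF from[] ψ
      hyp  : ∀ {φ} → φ ∈ Φ → Γ ∣ Φ ⊢ φ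
      ⊤I   : Γ ∣ Φ ⊢ ⊤ᶠ
      ⊥E   : ∀ {φ} → Γ ∣ Φ ⊢ ⊥ᶠ → Γ ∣ Φ ⊢ φ
      ∧I   : ∀ {φ ψ} → Γ ∣ Φ ⊢ φ → Γ ∣ Φ ⊢ ψ → Γ ∣ Φ ⊢ φ ∧ᶠ ψ
      ∧E₁  : ∀ {φ ψ} → Γ ∣ Φ ⊢ φ ∧ᶠ ψ → Γ ∣ Φ ⊢ φ
      ∧E₂  : ∀ {φ ψ} → Γ ∣ Φ ⊢ φ ∧ᶠ ψ → Γ ∣ Φ ⊢ ψ
      ∨I₁  : ∀ {φ ψ} → Γ ∣ Φ ⊢ φ → Γ ∣ Φ ⊢ φ ∨ᶠ ψ
      ∨I₂  : ∀ {φ ψ} → Γ ∣ Φ ⊢ ψ → Γ ∣ Φ ⊢ φ ∨ᶠ ψ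
      ∨E   : ∀ {φ ψ χ} → Γ ∣ Φ ⊢ φ ∨ᶠ ψ → Γ ∣ φ ∷ Φ ⊢ χ → Γ ∣ ψ ∷ Φ ⊢ χ → Γ ∣ Φ ⊢ χ
      ⇒I   : ∀ {φ ψ} → Γ ∣ φ ∷ Φ ⊢ ψ → Γ ∣ Φ ⊢ φ ⇒ᶠ ψ
      ⇒E   : ∀ {φ ψ} → Γ ∣ Φ ⊢ φ ⇒ᶠ ψ → Γ ∣ Φ ⊢ φ → Γ ∣ Φ ⊢ ψ
      ∀oI  : ∀ {φ} → (Γ ▷o) ∣ map wkF Φ ⊢ φ → Γ ∣ Φ ⊢ ∀o φ
      ∀oE  : ∀ {φ} → Γ ∣ Φ ⊢ ∀o φ → (X : OTm s) → Γ ∣ Φ ⊢ φ [ X ]o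
      ∃oI  : ∀ {φ} → (X : OTm s) → Γ ∣ Φ ⊢ φ [ X ]o → Γ ∣ Φ ⊢ ∃o φ
      ∃oE  : ∀ {φ ψ} → Γ ∣ Φ ⊢ ∃o φ → (Γ ▷o) ∣ φ ∷ map wkF Φ ⊢ wkF ψ → Γ ∣ Φ ⊢ ψ
      ∀aI  : ∀ {X Y φ} → (Γ ▷[ X ⇒ Y ]) ∣ map wkF Φ ⊢ φ → Γ ∣ Φ ⊢ ∀a X Y φ
      ∀aE  : ∀ {X Y φ f} → Γ ∣ Φ ⊢ ∀a X Y φ → Γ ⊢ f ∶ X ⟶ Y → Γ ∣ Φ ⊢ φ [ f ]a
      ∃aI  : ∀ {X Y φ f} → Γ ⊢ f ∶ X ⟶ Y → Γ ∣ Φ ⊢ φ [ f ]a → Γ ∣ Φ ⊢ ∃a X Y φ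
      ∃aE  : ∀ {X Y φ ψ} → Γ ∣ Φ ⊢ ∃a X Y φ → (Γ ▷[ X ⇒ Y ]) ∣ φ ∷ map wkF Φ ⊢ wkF ψ → Γ ∣ Φ ⊢ ψ
      ≐refl  : ∀ {f X Y} → Γ ⊢ f ∶ X ⟶ Y → Γ ∣ Φ ⊢ f ≐ f
      ≐subst : ∀ {f g X Y} (φ : Fm (arr ∷ s)) → Γ ⊢ f ∶ X ⟶ Y → Γ ⊢ g ∶ X ⟶ Y →
               Γ ∣ Φ ⊢ f ≐ g → Γ ∣ Φ ⊢ φ [ f ]a → Γ ∣ Φ ⊢ φ [ g ]a
      idL    : ∀ {f X Y} → Γ ⊢ f ∶ X ⟶ Y → Γ ∣ Φ ⊢ comp (idt Y) f ≐ f
      idR    : ∀ {f X Y} → Γ ⊢ f ∶ X ⟶ Y → Γ ∣ Φ ⊢ comp f (idt X) ≐ f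
      assoc  : ∀ {f g h X Y Z W} → Γ ⊢ f ∶ X ⟶ Y → Γ ⊢ g ∶ Y ⟶ Z → Γ ⊢ h ∶ Z ⟶ W →
               Γ ∣ Φ ⊢ comp h (comp g f) ≐ comp (comp h g) f

    Thm : Fm [] → Set
    Thm φ = ε ∣ [] ⊢ φ

record Theory : Set₁ where
  field
    sig  : Signature
  open Lang sig
  field
    Ax   : Fm [] → Set
    axWf : ∀ ψ → Ax ψ → ε ⊢wf ψ

module _ (T : Theory) where
  open Theory T
  open Lang sig
  open Deriv Ax

  TermComplete : Set
  TermComplete = ∀ {s} (Δ : Ctx s) (P : Fm s) → Δ ⊢wf P → Thm (ExU Δ P) →
    Σ (Sub s []) λ c → WfSub Δ ε c × Thm (subF c P)

  ExistenceProperty : Set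
  ExistenceProperty = ∀ {s} (Θ : Ctx s) (P : Fm s) → Θ ⊢wf P → Thm (exs Θ P) →
    Σ Scope λ t → Σ (Ctx t) λ Δ → Σ (Sub s t) λ c → Σ (Fm t) λ Q →
      WfSub Θ Δ c × Δ ⊢wf Q × Thm (ExU Δ Q) × Thm (exs Δ (Q ∧ᶠ subF c P))

  ClosedWitnessProperty : Set
  ClosedWitnessProperty = ∀ {s} (Δ : Ctx s) (P : Fm s) → Δ ⊢wf P → Thm (exs Δ P) →
    Σ (Sub s []) λ c → WfSub Δ ε c × Thm (subF c P)

-- Given a proof of ∃Δ P, the existence property yields a context Δ', a
-- variable assignment c : Δ → 𝒞(T)_Δ' and a formula Q with ∃!Δ' Q and
-- ∃Δ' (Q ∧ P(c)).  Uniqueness passes from Q to the stronger Q ∧ P(c), so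
-- term-completeness supplies closed terms d with T ⊢ Q(d) ∧ P(c)(d), and
-- d ∘ c is a closed witness for P.  Conversely a closed witness c gives the
-- existence property with the empty context Δ' and Q = ⊤.
module Submission where

open import Defs
open import Function.Bundles using (_⇔_; mk⇔)
open import Data.List using ([]; _∷_; map)
open import Data.List.Relation.Unary.Any using (here; there)
open import Data.Product using (_,_; proj₁; proj₂)
open import Relation.Binary.PropositionalEquality

cong₃ : ∀ {A B C D : Set} (f : A → B → C → D) {x x' y y' z z'} →
  x ≡ x' → y ≡ y' → z ≡ z' → f x y z ≡ f x' y' z'
cong₃ f refl refl refl = refl

module Substitution (Sg : Signature) where
  open Lang Sg

  infix 4 _≗ₛ_

  _≗ₛ_ : ∀ {s t} → Sub s t → Sub s t → Set
  σ ≗ₛ τ = ∀ {k} (v : Var _ k) → σ v ≡ τ v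

  subK : ∀ {k s t} → Sub s t → KTm k s → KTm k t
  subK {obj} = subO
  subK {arr} = subA

  _⊙_ : ∀ {s t u} → Sub t u → Sub s t → Sub s u
  (σ ⊙ τ) v = subK σ (τ v)

  subO-cong : ∀ {s t} {σ τ : Sub s t} → σ ≗ₛ τ → ∀ X → subO σ X ≡ subO τ X
  subO-cong e (ovar v) = e v
  subO-cong e (ocon c) = refl

  subA-cong : ∀ {s t} {σ τ : Sub s t} → σ ≗ₛ τ → ∀ f → subA σ f ≡ subA τ f
  subA-cong e (avar v)   = e v
  subA-cong e (acon a)   = refl
  subA-cong e (idt X)    = cong idt (subO-cong e X)
  subA-cong e (comp g f) = cong₂ comp (subA-cong e g) (subA-cong e f)

  subO-⊙ : ∀ {s t u} (σ : Sub t u) (τ : Sub s t) X → subO σ (subO τ X) ≡ subO (σ ⊙ τ) X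
  subO-⊙ σ τ (ovar v) = refl
  subO-⊙ σ τ (ocon c) = refl

  subA-⊙ : ∀ {s t u} (σ : Sub t u) (τ : Sub s t) f → subA σ (subA τ f) ≡ subA (σ ⊙ τ) f
  subA-⊙ σ τ (avar v)   = refl
  subA-⊙ σ τ (acon a)   = refl
  subA-⊙ σ τ (idt X)    = cong idt (subO-⊙ σ τ X)
  subA-⊙ σ τ (comp g f) = cong₂ comp (subA-⊙ σ τ g) (subA-⊙ σ τ f)

  subO-idS : ∀ {s} (X : OTm s) → subO idS X ≡ X
  subO-idS (ovar v) = refl
  subO-idS (ocon c) = refl

  subA-idS : ∀ {s} (f : ATm s) → subA idS f ≡ f
  subA-idS (avar v)   = refl
  subA-idS (acon a)   = refl
  subA-idS (idt X)    = cong idt (subO-idS X)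
  subA-idS (comp g f) = cong₂ comp (subA-idS g) (subA-idS f)

  renO-as-subO : ∀ {s t} (ρ : Ren s t) X → renO ρ X ≡ subO (λ v → idS (ρ v)) X
  renO-as-subO ρ (ovar v) = refl
  renO-as-subO ρ (ocon c) = refl

  subO-liftS-wk : ∀ {s t k'} (σ : Sub s t) X →
    subO (liftS {k' = k'} σ) (renO vs X) ≡ renO vs (subO σ X)
  subO-liftS-wk {k' = obj} σ (ovar v) = refl
  subO-liftS-wk {k' = arr} σ (ovar v) = refl
  subO-liftS-wk σ (ocon c) = refl

  subA-liftS-wk : ∀ {s t k'} (σ : Sub s t) f →
    subA (liftS {k' = k'} σ) (renA vs f) ≡ renA vs (subA σ f)
  subA-liftS-wk {k' = obj} σ (avar v) = refl
  subA-liftS-wk {k' = arr} σ (avar v) = refl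
  subA-liftS-wk σ (acon a)   = refl
  subA-liftS-wk σ (idt X)    = cong idt (subO-liftS-wk σ X)
  subA-liftS-wk σ (comp g f) = cong₂ comp (subA-liftS-wk σ g) (subA-liftS-wk σ f)

  subK-liftS-wk : ∀ {k s t k'} (σ : Sub s t) (x : KTm k s) →
    subK (liftS {k' = k'} σ) (renK vs x) ≡ renK vs (subK σ x)
  subK-liftS-wk {obj} = subO-liftS-wk
  subK-liftS-wk {arr} = subA-liftS-wk

  liftS-cong : ∀ {s t k'} {σ τ : Sub s t} → σ ≗ₛ τ → liftS {k' = k'} σ ≗ₛ liftS τ
  liftS-cong {k' = obj} e vz     = refl
  liftS-cong {k' = arr} e vz     = refl
  liftS-cong {k' = obj} e (vs v) = cong (renK vs) (e v)
  liftS-cong {k' = arr} e (vs v) = cong (renK vs) (e v)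

  liftS-⊙ : ∀ {s t u k'} (σ : Sub t u) (τ : Sub s t) →
    liftS {k' = k'} σ ⊙ liftS τ ≗ₛ liftS (σ ⊙ τ)
  liftS-⊙ {k' = obj} σ τ vz     = refl
  liftS-⊙ {k' = arr} σ τ vz     = refl
  liftS-⊙ {k' = obj} σ τ (vs v) = subK-liftS-wk σ (τ v)
  liftS-⊙ {k' = arr} σ τ (vs v) = subK-liftS-wk σ (τ v)

  liftS-idS : ∀ {s k'} → liftS {k' = k'} (idS {s}) ≗ₛ idS
  liftS-idS {k' = obj} vz             = refl
  liftS-idS {k' = arr} vz             = refl
  liftS-idS {k' = obj} {obj} (vs v)   = refl
  liftS-idS {k' = obj} {arr} (vs v)   = refl
  liftS-idS {k' = arr} {obj} (vs v)   = refl
  liftS-idS {k' = arr} {arr} (vs v)   = refl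

  subF-cong : ∀ {s t} {σ τ : Sub s t} → σ ≗ₛ τ → ∀ φ → subF σ φ ≡ subF τ φ
  subF-cong e ⊤ᶠ         = refl
  subF-cong e ⊥ᶠ         = refl
  subF-cong e (φ ∧ᶠ ψ)   = cong₂ _∧ᶠ_ (subF-cong e φ) (subF-cong e ψ)
  subF-cong e (φ ∨ᶠ ψ)   = cong₂ _∨ᶠ_ (subF-cong e φ) (subF-cong e ψ)
  subF-cong e (φ ⇒ᶠ ψ)   = cong₂ _⇒ᶠ_ (subF-cong e φ) (subF-cong e ψ)
  subF-cong e (f ≐ g)    = cong₂ _≐_ (subA-cong e f) (subA-cong e g)
  subF-cong e (∀o φ)     = cong ∀o (subF-cong (liftS-cong e) φ)
  subF-cong e (∃o φ)     = cong ∃o (subF-cong (liftS-cong e) φ)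
  subF-cong e (∀a X Y φ) =
    cong₃ ∀a (subO-cong e X) (subO-cong e Y) (subF-cong (liftS-cong e) φ)
  subF-cong e (∃a X Y φ) =
    cong₃ ∃a (subO-cong e X) (subO-cong e Y) (subF-cong (liftS-cong e) φ)

  subF-⊙-lift : ∀ {s t u k'} (σ : Sub t u) (τ : Sub s t) (φ : Fm (k' ∷ s)) →
    subF (liftS σ) (subF (liftS τ) φ) ≡ subF (liftS (σ ⊙ τ)) φ
  subF-⊙ : ∀ {s t u} (σ : Sub t u) (τ : Sub s t) φ → subF σ (subF τ φ) ≡ subF (σ ⊙ τ) φ
  subF-⊙ σ τ ⊤ᶠ         = refl
  subF-⊙ σ τ ⊥ᶠ         = refl
  subF-⊙ σ τ (φ ∧ᶠ ψ)   = cong₂ _∧ᶠ_ (subF-⊙ σ τ φ) (subF-⊙ σ τ ψ)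
  subF-⊙ σ τ (φ ∨ᶠ ψ)   = cong₂ _∨ᶠ_ (subF-⊙ σ τ φ) (subF-⊙ σ τ ψ)
  subF-⊙ σ τ (φ ⇒ᶠ ψ)   = cong₂ _⇒ᶠ_ (subF-⊙ σ τ φ) (subF-⊙ σ τ ψ)
  subF-⊙ σ τ (f ≐ g)    = cong₂ _≐_ (subA-⊙ σ τ f) (subA-⊙ σ τ g)
  subF-⊙ σ τ (∀o φ)     = cong ∀o (subF-⊙-lift σ τ φ)
  subF-⊙ σ τ (∃o φ)     = cong ∃o (subF-⊙-lift σ τ φ)
  subF-⊙ σ τ (∀a X Y φ) = cong₃ ∀a (subO-⊙ σ τ X) (subO-⊙ σ τ Y) (subF-⊙-lift σ τ φ)
  subF-⊙ σ τ (∃a X Y φ) = cong₃ ∃a (subO-⊙ σ τ X) (subO-⊙ σ τ Y) (subF-⊙-lift σ τ φ)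

  subF-⊙-lift σ τ φ = trans (subF-⊙ _ _ φ) (subF-cong (liftS-⊙ σ τ) φ)

  subF-idS-lift : ∀ {s k'} (φ : Fm (k' ∷ s)) → subF (liftS idS) φ ≡ φ
  subF-idS : ∀ {s} (φ : Fm s) → subF idS φ ≡ φ
  subF-idS ⊤ᶠ         = refl
  subF-idS ⊥ᶠ         = refl
  subF-idS (φ ∧ᶠ ψ)   = cong₂ _∧ᶠ_ (subF-idS φ) (subF-idS ψ)
  subF-idS (φ ∨ᶠ ψ)   = cong₂ _∨ᶠ_ (subF-idS φ) (subF-idS ψ)
  subF-idS (φ ⇒ᶠ ψ)   = cong₂ _⇒ᶠ_ (subF-idS φ) (subF-idS ψ)
  subF-idS (f ≐ g)    = cong₂ _≐_ (subA-idS f) (subA-idS g)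
  subF-idS (∀o φ)     = cong ∀o (subF-idS-lift φ)
  subF-idS (∃o φ)     = cong ∃o (subF-idS-lift φ)
  subF-idS (∀a X Y φ) = cong₃ ∀a (subO-idS X) (subO-idS Y) (subF-idS-lift φ)
  subF-idS (∃a X Y φ) = cong₃ ∃a (subO-idS X) (subO-idS Y) (subF-idS-lift φ)

  subF-idS-lift φ = trans (subF-cong liftS-idS φ) (subF-idS φ)

  extS-vz-⊙-liftS-wk : ∀ {s k} → extS {k ∷ s} {k} (idS vz) ⊙ liftS (λ v → idS (vs v)) ≗ₛ idS
  extS-vz-⊙-liftS-wk {k = obj} vz             = refl
  extS-vz-⊙-liftS-wk {k = arr} vz             = refl
  extS-vz-⊙-liftS-wk {k = obj} {obj} (vs v)   = refl
  extS-vz-⊙-liftS-wk {k = obj} {arr} (vs v)   = refl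
  extS-vz-⊙-liftS-wk {k = arr} {obj} (vs v)   = refl
  extS-vz-⊙-liftS-wk {k = arr} {arr} (vs v)   = refl

  wk-binder-inst-vz : ∀ {s k} (φ : Fm (k ∷ s)) →
    subF (extS (idS vz)) (subF (liftS (λ v → idS (vs v))) φ) ≡ φ
  wk-binder-inst-vz φ =
    trans (subF-⊙ _ _ φ) (trans (subF-cong extS-vz-⊙-liftS-wk φ) (subF-idS φ))

module Typing (Sg : Signature) where
  open Lang Sg
  open Substitution Sg

  Extends : ∀ {k s} → Ctx s → Ctx (k ∷ s) → Set
  Extends Γ Γ' =
    ∀ g → arrTy Γ' (vs g) ≡ (renO vs (proj₁ (arrTy Γ g)) , renO vs (proj₂ (arrTy Γ g)))

  ⊢-wk : ∀ {k s} {Γ : Ctx s} {Γ' : Ctx (k ∷ s)} → Extends Γ Γ' →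
    ∀ {f X Y} → Γ ⊢ f ∶ X ⟶ Y → Γ' ⊢ renA vs f ∶ renO vs X ⟶ renO vs Y
  ⊢-wk {Γ' = Γ'} e (tvar g) =
    subst (λ p → Γ' ⊢ avar (vs g) ∶ proj₁ p ⟶ proj₂ p) (e g) (tvar (vs g))
  ⊢-wk e (tcon a)    = tcon a
  ⊢-wk e (tid X)     = tid _
  ⊢-wk e (tcomp p q) = tcomp (⊢-wk e p) (⊢-wk e q)

  ⊢-sub : ∀ {s t} {Θ : Ctx s} {Δ : Ctx t} {c : Sub s t} → WfSub Θ Δ c →
    ∀ {f X Y} → Θ ⊢ f ∶ X ⟶ Y → Δ ⊢ subA c f ∶ subO c X ⟶ subO c Y
  ⊢-sub w (tvar g)    = w g
  ⊢-sub w (tcon a)    = tcon a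
  ⊢-sub w (tid X)     = tid _
  ⊢-sub w (tcomp p q) = tcomp (⊢-sub w p) (⊢-sub w q)

  WfSub-⊙ : ∀ {s t u} {Θ : Ctx s} {Δ : Ctx t} {Λ : Ctx u} {d : Sub t u} {c : Sub s t} →
    WfSub Δ Λ d → WfSub Θ Δ c → WfSub Θ Λ (d ⊙ c)
  WfSub-⊙ {Θ = Θ} {Λ = Λ} {d} {c} wd wc g =
    subst₂ (λ A B → Λ ⊢ subA d (c g) ∶ A ⟶ B)
      (subO-⊙ d c (proj₁ (arrTy Θ g))) (subO-⊙ d c (proj₂ (arrTy Θ g)))
      (⊢-sub wd (wc g))

  ⊢-liftS-wk : ∀ {k s t} {Θ : Ctx s} {Δ : Ctx t} {Δ' : Ctx (k ∷ t)} {c : Sub s t} →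
    Extends Δ Δ' → WfSub Θ Δ c → (g : Var s arr) →
    Δ' ⊢ renA vs (c g) ∶ subO (liftS c) (renO vs (proj₁ (arrTy Θ g)))
                       ⟶ subO (liftS c) (renO vs (proj₂ (arrTy Θ g)))
  ⊢-liftS-wk {Θ = Θ} {Δ' = Δ'} {c} e w g =
    subst₂ (λ A B → Δ' ⊢ renA vs (c g) ∶ A ⟶ B)
      (sym (subO-liftS-wk c (proj₁ (arrTy Θ g)))) (sym (subO-liftS-wk c (proj₂ (arrTy Θ g))))
      (⊢-wk e (w g))

  WfSub-liftS-obj : ∀ {s t} {Θ : Ctx s} {Δ : Ctx t} {c : Sub s t} → WfSub Θ Δ c →
    WfSub (Θ ▷o) (Δ ▷o) (liftS c)
  WfSub-liftS-obj {Θ = Θ} {Δ} {c} w (vs g) =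
    ⊢-liftS-wk {Θ = Θ} {Δ' = Δ ▷o} {c} (λ _ → refl) w g

  WfSub-liftS-arr : ∀ {s t} {Θ : Ctx s} {Δ : Ctx t} {c : Sub s t} {X Y} → WfSub Θ Δ c →
    WfSub (Θ ▷[ X ⇒ Y ]) (Δ ▷[ subO c X ⇒ subO c Y ]) (liftS c)
  WfSub-liftS-arr {Δ = Δ} {c} {X} {Y} w vz =
    subst₂ (λ A B → (Δ ▷[ subO c X ⇒ subO c Y ]) ⊢ avar vz ∶ A ⟶ B)
      (sym (subO-liftS-wk c X)) (sym (subO-liftS-wk c Y)) (tvar vz)
  WfSub-liftS-arr {Θ = Θ} {Δ} {c} {X} {Y} w (vs g) =
    ⊢-liftS-wk {Θ = Θ} {Δ' = Δ ▷[ subO c X ⇒ subO c Y ]} {c} (λ _ → refl) w g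

  ⊢wf-sub : ∀ {s t} {Θ : Ctx s} {Δ : Ctx t} {c : Sub s t} → WfSub Θ Δ c →
    ∀ {φ} → Θ ⊢wf φ → Δ ⊢wf subF c φ
  ⊢wf-sub w w⊤        = w⊤
  ⊢wf-sub w w⊥        = w⊥
  ⊢wf-sub w (w∧ p q)  = w∧ (⊢wf-sub w p) (⊢wf-sub w q)
  ⊢wf-sub w (w∨ p q)  = w∨ (⊢wf-sub w p) (⊢wf-sub w q)
  ⊢wf-sub w (w⇒ p q)  = w⇒ (⊢wf-sub w p) (⊢wf-sub w q)
  ⊢wf-sub w (w≐ p q)  = w≐ (⊢-sub w p) (⊢-sub w q)
  ⊢wf-sub w (w∀o p)   = w∀o (⊢wf-sub (WfSub-liftS-obj w) p)
  ⊢wf-sub w (w∃o p)   = w∃o (⊢wf-sub (WfSub-liftS-obj w) p)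
  ⊢wf-sub w (w∀a p)   = w∀a (⊢wf-sub (WfSub-liftS-arr w) p)
  ⊢wf-sub w (w∃a p)   = w∃a (⊢wf-sub (WfSub-liftS-arr w) p)

module Derivations (Sg : Signature) (Ax : Lang.Fm Sg [] → Set) where
  open Lang Sg
  open Deriv Ax
  open Substitution Sg

  ⊢-alls-mono : ∀ {b s} (E : Tel b s) {φ ψ : Fm s} →
    (∀ {Γ' : Ctx s} Ψ → Γ' ∣ Ψ ⊢ φ → Γ' ∣ Ψ ⊢ ψ) →
    ∀ {Γ : Ctx b} Ψ → Γ ∣ Ψ ⊢ alls E φ → Γ ∣ Ψ ⊢ alls E ψ
  ⊢-alls-mono ε f Ψ d = f Ψ d
  ⊢-alls-mono (E ▷o) {φ} {ψ} f = ⊢-alls-mono E ∀o-mono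
    where
    ∀o-mono : ∀ {Γ'} Ψ → Γ' ∣ Ψ ⊢ ∀o φ → Γ' ∣ Ψ ⊢ ∀o ψ
    ∀o-mono {Γ'} Ψ d = ⇒E (⇒I (∀oI (f _ body))) d
      where
      body : (Γ' ▷o) ∣ wkF (∀o φ) ∷ map wkF Ψ ⊢ φ
      body = subst ((Γ' ▷o) ∣ wkF (∀o φ) ∷ map wkF Ψ ⊢_)
               (wk-binder-inst-vz φ) (∀oE (hyp (here refl)) (ovar vz))
  ⊢-alls-mono (E ▷[ X ⇒ Y ]) {φ} {ψ} f = ⊢-alls-mono E ∀a-mono
    where
    ∀a-mono : ∀ {Γ'} Ψ → Γ' ∣ Ψ ⊢ ∀a X Y φ → Γ' ∣ Ψ ⊢ ∀a X Y ψ
    ∀a-mono {Γ'} Ψ d = ⇒E (⇒I (∀aI (f _ body))) d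
      where
      vz-typed : (Γ' ▷[ X ⇒ Y ]) ⊢ avar vz ∶ subO (λ v → idS (vs v)) X
                                             ⟶ subO (λ v → idS (vs v)) Y
      vz-typed = subst₂ ((Γ' ▷[ X ⇒ Y ]) ⊢ avar vz ∶_⟶_)
                   (renO-as-subO vs X) (renO-as-subO vs Y) (tvar vz)
      body : (Γ' ▷[ X ⇒ Y ]) ∣ wkF (∀a X Y φ) ∷ map wkF Ψ ⊢ φ
      body = subst ((Γ' ▷[ X ⇒ Y ]) ∣ wkF (∀a X Y φ) ∷ map wkF Ψ ⊢_)
               (wk-binder-inst-vz φ) (∀aE (hyp (here refl)) vz-typed)

  ExU-∧ : ∀ {t} (Δ : Ctx t) (Q R : Fm t) → Thm (ExU Δ Q) → Thm (exs Δ (Q ∧ᶠ R)) →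
    Thm (ExU Δ (Q ∧ᶠ R))
  ExU-∧ {t} Δ Q R uniqueQ existsQR =
    ∧I existsQR (⊢-alls-mono (Δ ++T copy Δ t) weaken-antecedent [] (∧E₂ uniqueQ))
    where
    weaken-antecedent : ∀ {s} {Γ' : Ctx s} {A₁ A₂ B₁ B₂ C : Fm s} Ψ →
      Γ' ∣ Ψ ⊢ (A₁ ∧ᶠ A₂) ⇒ᶠ C → Γ' ∣ Ψ ⊢ ((A₁ ∧ᶠ B₁) ∧ᶠ (A₂ ∧ᶠ B₂)) ⇒ᶠ C
    weaken-antecedent Ψ d =
      ⇒E (⇒I (⇒I (⇒E (hyp (there (here refl)))
        (∧I (∧E₁ (∧E₁ (hyp (here refl)))) (∧E₁ (∧E₂ (hyp (here refl)))))))) d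

mainTheorem4 : (T : Theory) → TermComplete T →
    (ExistenceProperty T ⇔ ClosedWitnessProperty T)
mainTheorem4 T termComplete = mk⇔ closedWitness existence
  where
  open Theory T
  open Lang sig
  open Deriv Ax
  open Substitution sig
  open Typing sig
  open Derivations sig Ax

  closedWitness : ExistenceProperty T → ClosedWitnessProperty T
  closedWitness ep Δ P wfP existsP with ep Δ P wfP existsP
  ... | _ , Δ' , c , Q , wc , wfQ , uniqueQ , existsQPc
    with termComplete Δ' (Q ∧ᶠ subF c P) (w∧ wfQ (⊢wf-sub wc wfP))
                      (ExU-∧ Δ' Q (subF c P) uniqueQ existsQPc)
  ... | d , wd , QPcd =
    d ⊙ c , WfSub-⊙ {Θ = Δ} {c = c} wd wc , subst Thm (subF-⊙ {u = []} d c P) (∧E₂ QPcd)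

  existence : ClosedWitnessProperty T → ExistenceProperty T
  existence cw Θ P wfP existsP with cw Θ P wfP existsP
  -- Over the empty context, ExU ε ⊤ᶠ unfolds to ⊤ ∧ ((⊤ ∧ ⊤) ⇒ (⊤ ∧ ((⊤ ∧ ⊤) ⇒ ⊤))).
  ... | c , wc , Pc = [] , ε , c , ⊤ᶠ , wc , w⊤ , ∧I ⊤I (⇒I (∧I ⊤I (⇒I ⊤I))) , ∧I ⊤I Pc
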